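{- Let $V$ be a complex vector space with $\dim V=k$ and let $D\subseteq\mathbb{Z}^2$ be a finite diagram. Then $V[D]\ne0$ if and only if every column of $D$ has at most $k$ cells.
   Context: Columns of $D$ are sets of cells with equal second coordinate and rows sets with equal first coordinate; $R(D),C(D)\subseteq S_D$ are the row/column stabilizers, $y_D=\sum_{p\in R(D),q\in C(D)}\operatorname{sgn}(q)qp$, and $V[D]=V^{\otimes D}y_D$, where $V^{\otimes D}$ is the tensor power indexed by $D$ with $S_D$ permuting factors on the right. -}

module Defs where

open import Level using (Level; _⊔_)
open import Algebra.Bundles using (CommutativeRing)
open import Data.Nat as ℕ using (ℕ; zero; suc; _<_; _≤_)
import Data.Nat.Properties as ℕₚ
open import Data.Integer as ℤ using (ℤ)
open import Data.Fin as Fin using (Fin)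
import Data.Fin.Properties as Finₚ
open import Data.Product using (Σ; ∃; _×_; _,_; proj₁; proj₂)
open import Data.List using (List; []; _∷_; map; concatMap; allFin; filter; length; foldr; lookup)
open import Data.Vec.Functional using () renaming (_∷_ to _∷ᶠ_)
open import Function using (_∘_)
open import Data.Bool using (true; false)
open import Relation.Nullary using (¬_; Dec; yes; no; does)
open import Relation.Nullary.Decidable using (_→-dec_; _×-dec_)
open import Relation.Binary.PropositionalEquality using (_≡_)

-- all functions Fin n → Fin m (the basis index set of V^{⊗D}, and S_D ⊆ it)
allFuns : (n m : ℕ) → List (Fin n → Fin m)
allFuns zero    m = (λ ()) ∷ []
allFuns (suc n) m = concatMap (λ a → map (λ f → a ∷ᶠ f) (allFuns n m)) (allFin m)

_≟fun_ : ∀ {n m} (f g : Fin n → Fin m) → Dec (∀ i → f i ≡ g i)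
f ≟fun g = Finₚ.all? (λ i → f i Fin.≟ g i)

-- σ : Fin n → Fin n is a permutation (injective on a finite set)
IsPerm : ∀ {n} → (Fin n → Fin n) → Set
IsPerm σ = ∀ i j → σ i ≡ σ j → i ≡ j

isPerm? : ∀ {n} (σ : Fin n → Fin n) → Dec (IsPerm σ)
isPerm? σ = Finₚ.all? (λ i → Finₚ.all? (λ j → (σ i Fin.≟ σ j) →-dec (i Fin.≟ j)))

allPerms : (n : ℕ) → List (Fin n → Fin n)
allPerms n = filter isPerm? (allFuns n n)

inversions : ∀ {n} → (Fin n → Fin n) → ℕ
inversions {n} σ =
  length (filter (λ ij → (proj₁ ij Fin.<? proj₂ ij) ×-dec (σ (proj₂ ij) Fin.<? σ (proj₁ ij)))
                 (concatMap (λ i → map (λ j → i , j) (allFin n)) (allFin n)))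

-- Diagrams: a finite diagram D ⊆ ℤ² is a duplicate-free list of cells
-- (row , column); the cells are indexed by Fin (length D).

Cell : Set
Cell = ℤ × ℤ

row col : Cell → ℤ
row = proj₁
col = proj₂

cell : (D : List Cell) → Fin (length D) → Cell
cell D = lookup D

columnSize : List Cell → ℤ → ℕ
columnSize D c = length (filter (λ x → col x ℤ.≟ c) D)

rowStab : (D : List Cell) → List (Fin (length D) → Fin (length D))
rowStab D = filter (λ σ → Finₚ.all? (λ i → row (cell D (σ i)) ℤ.≟ row (cell D i)))
                   (allPerms (length D))

colStab : (D : List Cell) → List (Fin (length D) → Fin (length D))
colStab D = filter (λ σ → Finₚ.all? (λ i → col (cell D (σ i)) ℤ.≟ col (cell D i)))
                   (allPerms (length D))

module _ {c ℓ : Level} (K : CommutativeRing c ℓ) where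
  open CommutativeRing K

  IsField : Set (c ⊔ ℓ)
  IsField = (¬ (0# ≈ 1#)) × (∀ x → ¬ (x ≈ 0#) → ∃ λ y → x * y ≈ 1#)

  natK : ℕ → Carrier
  natK zero    = 0#
  natK (suc n) = 1# + natK n

  CharZero : Set ℓ
  CharZero = ∀ n → natK n ≈ 0# → n ≡ 0

  sumK : List Carrier → Carrier
  sumK = foldr _+_ 0#

  signPow : ℕ → Carrier
  signPow zero    = 1#
  signPow (suc m) = - signPow m

  sgn : ∀ {n} → (Fin n → Fin n) → Carrier
  sgn σ = signPow (inversions σ)

  -- V = K^k with basis e_0..e_{k-1}; V^{⊗D} has basis e_f = ⊗_{d} e_{f d}
  -- for f : D → Fin k; a tensor is its coefficient function.
  Tensor : ℕ → ℕ → Set c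
  Tensor n k = (Fin n → Fin k) → Carrier

  indicator : ∀ {n k} (f g : Fin n → Fin k) → Carrier
  indicator f g with does (f ≟fun g)
  ... | true  = 1#
  ... | false = 0#

  -- S_n acts on the right by permuting factors:
  --   (v_1 ⊗ … ⊗ v_n) σ = v_{σ 1} ⊗ … ⊗ v_{σ n},  so  e_f σ = e_{f ∘ σ},
  -- and the product in S_n is qp = q ∘ p.
  -- x · y_D  with  y_D = Σ_{p ∈ R(D), q ∈ C(D)} sgn(q) q p :
  --   (x y_D)(g) = Σ_f x(f) Σ_{p,q} sgn(q) [f ∘ q ∘ p = g].
  applyYoung : (D : List Cell) (k : ℕ) → Tensor (length D) k → Tensor (length D) k
  applyYoung D k x g =
    sumK (map (λ f → x f *
      sumK (concatMap (λ p → map (λ q → sgn q * indicator (f ∘ q ∘ p) g) (colStab D))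
                      (rowStab D)))
      (allFuns (length D) k))

  -- V[D] = V^{⊗D} y_D is nonzero: some element x y_D has a nonzero coordinate
  VD≢0 : (D : List Cell) (k : ℕ) → Set (c ⊔ ℓ)
  VD≢0 D k = ∃ λ (x : Tensor (length D) k) → ∃ λ g → ¬ (applyYoung D k x g ≈ 0#)

module Submission where

-- The coordinate of e_f y_D at e_g is  Σ_{p ∈ R(D), q ∈ C(D)} sgn(q) [f ∘ q ∘ p = g].
-- (⇒) If a column has more than k cells, each f : D → Fin k repeats a value on two
--     cells a ≠ b of that column (pigeonhole).  Then q ↦ (a b) q is an involution of
--     C(D) reversing sgn q and fixing f ∘ q ∘ p, so each inner sum over C(D) equals its
--     own negative and vanishes, as 2 is invertible.  Hence x y_D = 0 for every x.
-- (⇐) Otherwise label each cell by its rank in its column, f₀ : D → Fin k.  If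
--     f₀ ∘ q ∘ p = f₀ with p ∈ R(D), q ∈ C(D), then q = id (induction over the rows), so
--     the coordinate of e_{f₀} y_D at e_{f₀} counts the p ∈ R(D) with f₀ ∘ p = f₀: a
--     positive integer, hence nonzero in characteristic zero.

open import Defs
open import Level using (Level; 0ℓ)
open import Algebra.Bundles using (CommutativeRing)
open import Data.Integer as Int using (ℤ)
import Data.Integer.Properties as Intₚ
open import Data.List.Relation.Unary.Unique.Propositional using (Unique)
open import Function.Bundles using (_⇔_; mk⇔)
open import Data.Nat as Nat using (ℕ; zero; suc; _≤_; _<_; z≤n; s≤s)
import Data.Nat.Properties as ℕₚ
open import Data.Nat.Tactic.RingSolver using (solve-∀)
import Algebra.Properties.Semiring.Sum as SemiringSum
import Algebra.Properties.Ring as RingProperties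
import Relation.Binary.Reasoning.Setoid as SetoidReasoning
open import Data.Fin as Fin using (Fin; toℕ)
import Data.Fin.Properties as Finₚ
open import Data.Product using (∃; _×_; _,_; proj₁; proj₂)
open import Data.Sum using (inj₁; inj₂)
open import Data.Empty using (⊥-elim)
open import Data.List using (List; []; _∷_; _++_; map; concatMap; allFin; filter; length; tabulate; lookup)
open import Data.Vec.Functional using () renaming (_∷_ to _∷ᶠ_)
import Data.List.Properties as Listₚ
open import Data.List.Membership.Propositional using (_∈_; lose)
open import Data.List.Relation.Unary.Any using (here; there)
import Data.List.Membership.Propositional.Properties as Memₚ
import Data.List.Relation.Unary.All as All
import Data.List.Relation.Unary.Unique.Propositional.Properties as Uniqueₚ
open import Data.List.Relation.Unary.AllPairs using (_∷_)
open import Function using (_∘_; id)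
open import Data.Fin.Permutation using (Permutation; permutation)
open import Relation.Nullary using (¬_; Dec; yes; no)
open import Relation.Nullary.Decidable using (_×-dec_; dec-true; dec-false)
open import Relation.Unary using (Pred; Decidable)
open import Relation.Binary.Definitions using (tri<; tri≈; tri>)
open import Relation.Binary.PropositionalEquality as ≡ using (_≡_; _≢_; refl)

module FiniteSums where

  open Nat using (_+_; _*_)
  open ≡ using (sym; trans; cong; module ≡-Reasoning)

  open SemiringSum ℕₚ.+-*-semiring public using (sum; sum-cong-≗; ∑-distrib-+; *-distribˡ-sum; sum-permute)

  𝟙 : ∀ {p} {P : Set p} → Dec P → ℕ
  𝟙 (yes _) = 1
  𝟙 (no _)  = 0

  𝟙≤1 : ∀ {p} {P : Set p} (d : Dec P) → 𝟙 d ≤ 1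
  𝟙≤1 (yes _) = s≤s z≤n
  𝟙≤1 (no _)  = z≤n

  𝟙-× : ∀ {p q} {P : Set p} {Q : Set q} (a : Dec P) (b : Dec Q) → 𝟙 (a ×-dec b) ≡ 𝟙 a * 𝟙 b
  𝟙-× (yes _) (yes _) = refl
  𝟙-× (yes _) (no _)  = refl
  𝟙-× (no _)  _       = refl

  𝟙-yes : ∀ {p} {P : Set p} (d : Dec P) → P → 𝟙 d ≡ 1
  𝟙-yes (yes _) _ = refl
  𝟙-yes (no ¬p) p = ⊥-elim (¬p p)

  𝟙-no : ∀ {p} {P : Set p} (d : Dec P) → ¬ P → 𝟙 d ≡ 0
  𝟙-no (yes p) ¬p = ⊥-elim (¬p p)
  𝟙-no (no _)  _  = refl

  𝟙-cong : ∀ {p q} {P : Set p} {Q : Set q} → (P → Q) → (Q → P) → (dP : Dec P) (dQ : Dec Q) → 𝟙 dP ≡ 𝟙 dQ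
  𝟙-cong P→Q Q→P (yes p) dQ = sym (𝟙-yes dQ (P→Q p))
  𝟙-cong P→Q Q→P (no ¬p) dQ = sym (𝟙-no dQ (¬p ∘ Q→P))

  𝟙-double : ∀ {p} {P : Set p} (d : Dec P) → 𝟙 d + 𝟙 d ≡ 2 * (𝟙 d * 𝟙 d)
  𝟙-double (yes _) = refl
  𝟙-double (no _)  = refl

  𝟙-<-total : ∀ {n} {x y : Fin n} → x ≢ y → 𝟙 (x Fin.<? y) + 𝟙 (y Fin.<? x) ≡ 1
  𝟙-<-total {x = x} {y} x≢y with x Fin.<? y | y Fin.<? x
  ... | yes x<y | yes y<x = ⊥-elim (ℕₚ.<-asym x<y y<x)
  ... | yes _   | no _    = refl
  ... | no _    | yes _   = refl
  ... | no x≮y  | no y≮x  = ⊥-elim (x≢y (Finₚ.≤-antisym (ℕₚ.≮⇒≥ y≮x) (ℕₚ.≮⇒≥ x≮y)))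

  sum-zero : ∀ n → sum {n} (λ _ → 0) ≡ 0
  sum-zero zero    = refl
  sum-zero (suc n) = sum-zero n

  sum-mono-≤ : ∀ {n} {f g : Fin n → ℕ} → (∀ i → f i ≤ g i) → sum f ≤ sum g
  sum-mono-≤ {zero}  f≤g = z≤n
  sum-mono-≤ {suc n} f≤g = ℕₚ.+-mono-≤ (f≤g Fin.zero) (sum-mono-≤ (f≤g ∘ Fin.suc))

  sum-mono-< : ∀ {n} {f g : Fin n → ℕ} → (∀ i → f i ≤ g i) → ∀ j → f j < g j → sum f < sum g
  sum-mono-< {suc n} f≤g Fin.zero    f<g = ℕₚ.+-mono-<-≤ f<g (sum-mono-≤ (f≤g ∘ Fin.suc))
  sum-mono-< {suc n} f≤g (Fin.suc j) f<g = ℕₚ.+-mono-≤-< (f≤g Fin.zero) (sum-mono-< (f≤g ∘ Fin.suc) j f<g)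

  sum-≤-rigid : ∀ {n} {f g : Fin n → ℕ} → (∀ i → f i ≤ g i) → sum f ≡ sum g → ∀ j → f j ≡ g j
  sum-≤-rigid f≤g Σf≡Σg j with ℕₚ.m≤n⇒m<n∨m≡n (f≤g j)
  ... | inj₂ fj≡gj = fj≡gj
  ... | inj₁ fj<gj = ⊥-elim (ℕₚ.<-irrefl Σf≡Σg (sum-mono-< f≤g j fj<gj))

  sum-𝟙-point : ∀ {n} (y : Fin n) (F : Fin n → ℕ) → sum (λ j → 𝟙 (j Fin.≟ y) * F j) ≡ F y
  sum-𝟙-point {suc n} Fin.zero F = begin
    F Fin.zero + 0 + sum (λ j → 0 * F (Fin.suc j)) ≡⟨ cong (F Fin.zero + 0 +_) (sum-zero n) ⟩
    F Fin.zero + 0 + 0                              ≡⟨ ℕₚ.+-identityʳ _ ⟩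
    F Fin.zero + 0                                  ≡⟨ ℕₚ.+-identityʳ _ ⟩
    F Fin.zero                                      ∎
    where open ≡-Reasoning
  sum-𝟙-point {suc n} (Fin.suc y) F =
    trans (sum-cong-≗ (λ j → cong (_* F (Fin.suc j)) (𝟙-suc j))) (sum-𝟙-point y (F ∘ Fin.suc))
    where
    𝟙-suc : ∀ j → 𝟙 (Fin.suc j Fin.≟ Fin.suc y) ≡ 𝟙 (j Fin.≟ y)
    𝟙-suc j with j Fin.≟ y
    ... | yes _ = refl
    ... | no _  = refl

  sum₂ : ∀ {n} → (Fin n → Fin n → ℕ) → ℕ
  sum₂ F = sum (λ i → sum (F i))

  sum₂-cong : ∀ {n} {F G : Fin n → Fin n → ℕ} → (∀ i j → F i j ≡ G i j) → sum₂ F ≡ sum₂ G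
  sum₂-cong F≗G = sum-cong-≗ (λ i → sum-cong-≗ (F≗G i))

  sum₂-+ : ∀ {n} (F G : Fin n → Fin n → ℕ) → sum₂ (λ i j → F i j + G i j) ≡ sum₂ F + sum₂ G
  sum₂-+ F G = trans (sum-cong-≗ (λ i → ∑-distrib-+ (F i) (G i))) (∑-distrib-+ (λ i → sum (F i)) (λ i → sum (G i)))

  sum₂-*ˡ : ∀ {n} c (F : Fin n → Fin n → ℕ) → sum₂ (λ i j → c * F i j) ≡ c * sum₂ F
  sum₂-*ˡ c F = trans (sum-cong-≗ (λ i → sym (*-distribˡ-sum c (F i)))) (sym (*-distribˡ-sum c (λ i → sum (F i))))

  sum₂-point : ∀ {n} (x y : Fin n) (F : Fin n → Fin n → ℕ) →
               sum₂ (λ i j → F i j * 𝟙 ((i Fin.≟ x) ×-dec (j Fin.≟ y))) ≡ F x y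
  sum₂-point x y F = begin
    sum₂ (λ i j → F i j * 𝟙 ((i Fin.≟ x) ×-dec (j Fin.≟ y)))
      ≡⟨ sum₂-cong (λ i j → trans (cong (F i j *_) (𝟙-× (i Fin.≟ x) (j Fin.≟ y))) (rearrange (F i j) (𝟙 (i Fin.≟ x)) (𝟙 (j Fin.≟ y)))) ⟩
    sum (λ i → sum (λ j → 𝟙 (i Fin.≟ x) * (𝟙 (j Fin.≟ y) * F i j)))
      ≡⟨ sum-cong-≗ (λ i → *-distribˡ-sum (𝟙 (i Fin.≟ x)) (λ j → 𝟙 (j Fin.≟ y) * F i j)) ⟨
    sum (λ i → 𝟙 (i Fin.≟ x) * sum (λ j → 𝟙 (j Fin.≟ y) * F i j))
      ≡⟨ sum-𝟙-point x (λ i → sum (λ j → 𝟙 (j Fin.≟ y) * F i j)) ⟩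
    sum (λ j → 𝟙 (j Fin.≟ y) * F x j)
      ≡⟨ sum-𝟙-point y (F x) ⟩
    F x y ∎
    where
    open ≡-Reasoning
    rearrange : ∀ f a b → f * (a * b) ≡ a * (b * f)
    rearrange = solve-∀

  module _ {a p : Level} {A : Set a} {P : Pred A p} (P? : Decidable P) where

    count-tabulate : ∀ {n} (g : Fin n → A) → length (filter P? (tabulate g)) ≡ sum (λ i → 𝟙 (P? (g i)))
    count-tabulate {zero}  g = refl
    count-tabulate {suc n} g with P? (g Fin.zero)
    ... | yes _ = cong suc (count-tabulate (g ∘ Fin.suc))
    ... | no _  = count-tabulate (g ∘ Fin.suc)

    count-lookup : (xs : List A) → length (filter P? xs) ≡ sum (λ i → 𝟙 (P? (lookup xs i)))
    count-lookup xs = trans (cong (length ∘ filter P?) (sym (Listₚ.tabulate-lookup xs))) (count-tabulate (lookup xs))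

    count-concat-tabulate : ∀ {b} {B : Set b} {n} (F : B → List A) (g : Fin n → B) →
      length (filter P? (concatMap F (tabulate g))) ≡ sum (λ i → length (filter P? (F (g i))))
    count-concat-tabulate {n = zero}  F g = refl
    count-concat-tabulate {n = suc n} F g = begin
      length (filter P? (F (g Fin.zero) ++ rest))
        ≡⟨ cong length (Listₚ.filter-++ P? (F (g Fin.zero)) rest) ⟩
      length (filter P? (F (g Fin.zero)) ++ filter P? rest)
        ≡⟨ Listₚ.length-++ (filter P? (F (g Fin.zero))) ⟩
      length (filter P? (F (g Fin.zero))) + length (filter P? rest)
        ≡⟨ cong (length (filter P? (F (g Fin.zero))) +_) (count-concat-tabulate F (g ∘ Fin.suc)) ⟩
      sum (λ i → length (filter P? (F (g i)))) ∎
      where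
      open ≡-Reasoning
      rest : List A
      rest = concatMap F (tabulate (g ∘ Fin.suc))

open FiniteSums

module Permutations where

  open Nat using (_+_; _*_)
  open ≡ using (sym; trans; cong; cong₂; subst; subst₂; module ≡-Reasoning)

  perm-surjective : ∀ {n} (σ : Fin n → Fin n) → IsPerm σ → ∀ v → ∃ λ i → σ i ≡ v
  perm-surjective σ σ-inj v with Finₚ.any? (λ i → σ i Finₚ.≟ v)
  ... | yes hit = hit
  perm-surjective {suc m} σ σ-inj v | no miss =
    ⊥-elim (ℕₚ.<-irrefl refl (Finₚ.injective⇒≤ squeeze-injective))
    where
    avoids : ∀ i → v ≢ σ i
    avoids i v≡σi = miss (i , sym v≡σi)
    -- σ misses v, so it factors injectively through Fin m.
    squeeze : Fin (suc m) → Fin m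
    squeeze i = Fin.punchOut (avoids i)
    squeeze-injective : ∀ {i j} → squeeze i ≡ squeeze j → i ≡ j
    squeeze-injective {i} {j} eq = σ-inj i j (Finₚ.punchOut-injective (avoids i) (avoids j) eq)

  perm-inverse : ∀ {n} (σ : Fin n → Fin n) → IsPerm σ → Fin n → Fin n
  perm-inverse σ σ-perm v = proj₁ (perm-surjective σ σ-perm v)

  perm-inverseʳ : ∀ {n} (σ : Fin n → Fin n) (σ-perm : IsPerm σ) v → σ (perm-inverse σ σ-perm v) ≡ v
  perm-inverseʳ σ σ-perm v = proj₂ (perm-surjective σ σ-perm v)

  -- The same permutation as a library Permutation, to reuse its summation lemmas.
  toPermutation : ∀ {n} (σ : Fin n → Fin n) → IsPerm σ → Permutation n n
  toPermutation σ σ-perm = permutation σ (perm-inverse σ σ-perm) (perm-inverseʳ σ σ-perm)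
    (λ i → σ-perm _ _ (perm-inverseʳ σ σ-perm (σ i)))

  IsPerm-∘ : ∀ {n} {σ τ : Fin n → Fin n} → IsPerm σ → IsPerm τ → IsPerm (σ ∘ τ)
  IsPerm-∘ σ-perm τ-perm i j eq = τ-perm i j (σ-perm _ _ eq)

  IsPerm-resp-≗ : ∀ {n} {σ τ : Fin n → Fin n} → (∀ i → σ i ≡ τ i) → IsPerm σ → IsPerm τ
  IsPerm-resp-≗ σ≗τ σ-perm i j eq = σ-perm i j (trans (σ≗τ i) (trans eq (sym (σ≗τ j))))

  sum-reindex : ∀ {n} (σ : Fin n → Fin n) → IsPerm σ → (f : Fin n → ℕ) → sum (f ∘ σ) ≡ sum f
  sum-reindex σ σ-perm f = sym (sum-permute f (toPermutation σ σ-perm))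

  swap : ∀ {n} → Fin n → Fin n → Fin n → Fin n
  swap a b i with i Fin.≟ a
  ... | yes _ = b
  ... | no _ with i Fin.≟ b
  ...   | yes _ = a
  ...   | no _  = i

  swap-a : ∀ {n} (a b : Fin n) → swap a b a ≡ b
  swap-a a b with a Fin.≟ a
  ... | yes _   = refl
  ... | no a≢a = ⊥-elim (a≢a refl)

  swap-b : ∀ {n} (a b : Fin n) → swap a b b ≡ a
  swap-b a b with b Fin.≟ a
  ... | yes b≡a = b≡a
  ... | no _ with b Fin.≟ b
  ...   | yes _   = refl
  ...   | no b≢b = ⊥-elim (b≢b refl)

  swap-other : ∀ {n} {a b i : Fin n} → i ≢ a → i ≢ b → swap a b i ≡ i
  swap-other {a = a} {b} {i} i≢a i≢b with i Fin.≟ a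
  ... | yes i≡a = ⊥-elim (i≢a i≡a)
  ... | no _ with i Fin.≟ b
  ...   | yes i≡b = ⊥-elim (i≢b i≡b)
  ...   | no _    = refl

  data SwapView {n} (a b i : Fin n) : Set where
    at-a  : i ≡ a → SwapView a b i
    at-b  : i ≢ a → i ≡ b → SwapView a b i
    fixed : i ≢ a → i ≢ b → SwapView a b i

  swapView : ∀ {n} (a b i : Fin n) → SwapView a b i
  swapView a b i with i Fin.≟ a | i Fin.≟ b
  ... | yes i≡a | _       = at-a i≡a
  ... | no i≢a  | yes i≡b = at-b i≢a i≡b
  ... | no i≢a  | no i≢b  = fixed i≢a i≢b

  swap-involutive : ∀ {n} (a b i : Fin n) → swap a b (swap a b i) ≡ i
  swap-involutive a b i with swapView a b i
  ... | at-a refl       = trans (cong (swap i b) (swap-a i b)) (swap-b i b)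
  ... | at-b _ refl     = trans (cong (swap a i) (swap-b a i)) (swap-a a i)
  ... | fixed i≢a i≢b   = trans (cong (swap a b) (swap-other i≢a i≢b)) (swap-other i≢a i≢b)

  swap-IsPerm : ∀ {n} (a b : Fin n) → IsPerm (swap a b)
  swap-IsPerm a b i j eq =
    trans (sym (swap-involutive a b i)) (trans (cong (swap a b) eq) (swap-involutive a b j))

  swap-comm : ∀ {n} (a b i : Fin n) → swap a b i ≡ swap b a i
  swap-comm a b i with swapView a b i
  ... | at-a refl          = trans (swap-a i b) (sym (swap-b b i))
  ... | at-b i≢a refl      = trans (swap-b a i) (sym (swap-a i a))
  ... | fixed i≢a i≢b      = trans (swap-other i≢a i≢b) (sym (swap-other i≢b i≢a))

  swap-invariant : ∀ {n x} {X : Set x} (h : Fin n → X) {a b : Fin n} → h a ≡ h b → ∀ i → h (swap a b i) ≡ h i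
  swap-invariant h {a} {b} ha≡hb i with swapView a b i
  ... | at-a refl     = trans (cong h (swap-a i b)) (sym ha≡hb)
  ... | at-b _ refl   = trans (cong h (swap-b a i)) ha≡hb
  ... | fixed i≢a i≢b = cong h (swap-other i≢a i≢b)

  swap-conjugate : ∀ {n} {a a' b : Fin n} → a ≢ a' → a ≢ b → a' ≢ b →
                   ∀ i → swap a b i ≡ swap a a' (swap a' b (swap a a' i))
  swap-conjugate {a = a} {a'} {b} a≢a' a≢b a'≢b i with swapView a a' i
  ... | at-a refl = begin
    swap i b i                             ≡⟨ swap-a i b ⟩
    b                                      ≡⟨ swap-other (a≢b ∘ sym) (a'≢b ∘ sym) ⟨
    swap i a' b                            ≡⟨ cong (swap i a') (swap-a a' b) ⟨
    swap i a' (swap a' b a')               ≡⟨ cong (swap i a' ∘ swap a' b) (swap-a i a') ⟨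
    swap i a' (swap a' b (swap i a' i))    ∎
    where open ≡-Reasoning
  ... | at-b i≢a refl = begin
    swap a b i                             ≡⟨ swap-other i≢a a'≢b ⟩
    i                                      ≡⟨ swap-a a i ⟨
    swap a i a                             ≡⟨ cong (swap a i) (swap-other a≢a' a≢b) ⟨
    swap a i (swap i b a)                  ≡⟨ cong (swap a i ∘ swap i b) (swap-b a i) ⟨
    swap a i (swap i b (swap a i i))       ∎
    where open ≡-Reasoning
  ... | fixed i≢a i≢a' with i Fin.≟ b
  ...   | yes refl = begin
    swap a i i                             ≡⟨ swap-b a i ⟩
    a                                      ≡⟨ swap-b a a' ⟨
    swap a a' a'                           ≡⟨ cong (swap a a') (swap-b a' i) ⟨
    swap a a' (swap a' i i)                ≡⟨ cong (swap a a' ∘ swap a' i) (swap-other i≢a i≢a') ⟨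
    swap a a' (swap a' i (swap a a' i))    ∎
    where open ≡-Reasoning
  ...   | no i≢b = begin
    swap a b i                             ≡⟨ swap-other i≢a i≢b ⟩
    i                                      ≡⟨ swap-other i≢a i≢a' ⟨
    swap a a' i                            ≡⟨ cong (swap a a') (swap-other i≢a' i≢b) ⟨
    swap a a' (swap a' b i)                ≡⟨ cong (swap a a' ∘ swap a' b) (swap-other i≢a i≢a') ⟨
    swap a a' (swap a' b (swap a a' i))    ∎
    where open ≡-Reasoning

  inverted : ∀ {n} → (Fin n → Fin n) → Fin n → Fin n → ℕ
  inverted σ i j = 𝟙 (i Fin.<? j) * 𝟙 (σ j Fin.<? σ i)

  inversions-sum : ∀ {n} (σ : Fin n → Fin n) → inversions σ ≡ sum₂ (inverted σ)
  inversions-sum {n} σ = trans (count-concat-tabulate isInversion? (λ i → map (i ,_) (allFin n)) id)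
    (sum-cong-≗ λ i → begin
      length (filter isInversion? (map (i ,_) (allFin n))) ≡⟨ cong (length ∘ filter isInversion?) (Listₚ.map-tabulate id (i ,_)) ⟩
      length (filter isInversion? (tabulate (i ,_)))      ≡⟨ count-tabulate isInversion? (i ,_) ⟩
      sum (λ j → 𝟙 (isInversion? (i , j)))                ≡⟨ sum-cong-≗ (λ j → 𝟙-× (i Fin.<? j) (σ j Fin.<? σ i)) ⟩
      sum (inverted σ i)                                  ∎)
    where
    open ≡-Reasoning
    isInversion? : (ij : Fin n × Fin n) → Dec ((proj₁ ij Fin.< proj₂ ij) × (σ (proj₂ ij) Fin.< σ (proj₁ ij)))
    isInversion? (i , j) = (i Fin.<? j) ×-dec (σ j Fin.<? σ i)

  inversions-cong : ∀ {n} {σ τ : Fin n → Fin n} → (∀ i → σ i ≡ τ i) → inversions σ ≡ inversions τ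
  inversions-cong {σ = σ} {τ} σ≗τ = begin
    inversions σ                        ≡⟨ inversions-sum σ ⟩
    sum₂ (inverted σ)                   ≡⟨ sum₂-cong (λ i j → cong₂ (λ a b → 𝟙 (i Fin.<? j) * 𝟙 (a Fin.<? b)) (σ≗τ j) (σ≗τ i)) ⟩
    sum₂ (inverted τ)                   ≡⟨ inversions-sum τ ⟨
    inversions τ                        ∎
    where open ≡-Reasoning

  inversions-id : ∀ n → inversions {n} id ≡ 0
  inversions-id n = begin
    inversions {n} id                     ≡⟨ inversions-sum {n} id ⟩
    sum₂ (inverted {n} id)                ≡⟨ sum₂-cong not-inverted ⟩
    sum₂ {n} (λ _ _ → 0)                  ≡⟨ trans (sum-cong-≗ {n} (λ _ → sum-zero n)) (sum-zero n) ⟩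
    0                                     ∎
    where
    open ≡-Reasoning
    not-inverted : ∀ (i j : Fin n) → inverted id i j ≡ 0
    not-inverted i j with i Fin.<? j | j Fin.<? i
    ... | yes i<j | yes j<i = ⊥-elim (ℕₚ.<-asym i<j j<i)
    ... | yes _   | no _    = refl
    ... | no _    | _       = refl

  -- Composing with an adjacent transposition (v v+1) changes the number of inversions
  -- by an odd amount: the relative order of two values changes only for the pair {v, v+1}.
  module AdjacentSwap {n} (v v' : Fin n) (v'≡1+v : toℕ v' ≡ suc (toℕ v)) where

    s : Fin n → Fin n
    s = swap v v'

    v<v' : v Fin.< v'
    v<v' = subst (toℕ v <_) (sym v'≡1+v) (ℕₚ.n<1+n (toℕ v))

    v≢v' : v ≢ v'
    v≢v' = Finₚ.<⇒≢ v<v'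

    s-monotone : ∀ {u w} → w Fin.< u → ¬ (u ≡ v' × w ≡ v) → s w Fin.< s u
    s-monotone {u} {w} w<u exc with swapView v v' u | swapView v v' w
    ... | at-a refl     | at-a refl     = ⊥-elim (ℕₚ.<-irrefl refl w<u)
    ... | at-a refl     | at-b _ refl   = ⊥-elim (ℕₚ.<-asym w<u v<v')
    ... | at-a refl     | fixed w≢v w≢v' rewrite swap-a u v' | swap-other w≢v w≢v' = ℕₚ.<-trans w<u v<v'
    ... | at-b _ refl   | at-a refl     = ⊥-elim (exc (refl , refl))
    ... | at-b _ refl   | at-b _ refl   = ⊥-elim (ℕₚ.<-irrefl refl w<u)
    ... | at-b _ refl   | fixed w≢v w≢v' rewrite swap-b v u | swap-other w≢v w≢v' =
      ℕₚ.≤∧≢⇒< (ℕₚ.≤-pred (subst (toℕ w <_) v'≡1+v w<u)) (w≢v ∘ Finₚ.toℕ-injective)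
    ... | fixed u≢v u≢v' | at-a refl    rewrite swap-a w v' | swap-other u≢v u≢v' =
      ℕₚ.≤∧≢⇒< (subst (_≤ toℕ u) (sym v'≡1+v) w<u) (u≢v' ∘ sym ∘ Finₚ.toℕ-injective)
    ... | fixed u≢v u≢v' | at-b _ refl  rewrite swap-b v w | swap-other u≢v u≢v' = ℕₚ.<-trans v<v' w<u
    ... | fixed u≢v u≢v' | fixed w≢v w≢v' rewrite swap-other u≢v u≢v' | swap-other w≢v w≢v' = w<u

    s-reflects : ∀ {u w} → s w Fin.< s u → ¬ (u ≡ v × w ≡ v') → w Fin.< u
    s-reflects {u} {w} sw<su exc =
      subst₂ Fin._<_ (swap-involutive v v' w) (swap-involutive v v' u) (s-monotone sw<su exc')
      where
      exc' : ¬ (s u ≡ v' × s w ≡ v)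
      exc' (su≡v' , sw≡v) = exc ( trans (sym (swap-involutive v v' u)) (trans (cong s su≡v') (swap-b v v'))
                                , trans (sym (swap-involutive v v' w)) (trans (cong s sw≡v) (swap-a v v')))

    exceptional : Fin n → Fin n → ℕ
    exceptional u w = 𝟙 ((u Fin.≟ v) ×-dec (w Fin.≟ v')) + 𝟙 ((u Fin.≟ v') ×-dec (w Fin.≟ v))

    pair-identity : ∀ u w → 𝟙 (s w Fin.<? s u) + 𝟙 (w Fin.<? u) ≡ 2 * (𝟙 (w Fin.<? u) * 𝟙 (s w Fin.<? s u)) + exceptional u w
    pair-identity u w with (u Fin.≟ v) ×-dec (w Fin.≟ v') | (u Fin.≟ v') ×-dec (w Fin.≟ v)
    ... | yes (refl , refl) | yes (v≡v' , _) = ⊥-elim (v≢v' v≡v')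
    ... | yes (refl , refl) | no _ = flipped
      (𝟙-yes (s v' Fin.<? s v) (subst₂ Fin._<_ (sym (swap-b v v')) (sym (swap-a v v')) v<v'))
      (𝟙-no (v' Fin.<? v) (ℕₚ.<-asym v<v'))
      where
      flipped : ∀ {a b} → a ≡ 1 → b ≡ 0 → a + b ≡ 2 * (b * a) + (1 + 0)
      flipped refl refl = refl
    ... | no _ | yes (refl , refl) = flipped
      (𝟙-no (s v Fin.<? s v') (ℕₚ.<-asym (subst₂ Fin._<_ (sym (swap-b v v')) (sym (swap-a v v')) v<v')))
      (𝟙-yes (v Fin.<? v') v<v')
      where
      flipped : ∀ {a b} → a ≡ 0 → b ≡ 1 → a + b ≡ 2 * (b * a) + (0 + 1)
      flipped refl refl = refl
    ... | no ¬vv' | no ¬v'v = begin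
      𝟙 (s w Fin.<? s u) + 𝟙 (w Fin.<? u)            ≡⟨ cong (_+ 𝟙 (w Fin.<? u)) same-order ⟩
      𝟙 (w Fin.<? u) + 𝟙 (w Fin.<? u)                ≡⟨ 𝟙-double (w Fin.<? u) ⟩
      2 * (𝟙 (w Fin.<? u) * 𝟙 (w Fin.<? u))          ≡⟨ cong (λ a → 2 * (𝟙 (w Fin.<? u) * a)) same-order ⟨
      2 * (𝟙 (w Fin.<? u) * 𝟙 (s w Fin.<? s u))      ≡⟨ ℕₚ.+-identityʳ _ ⟨
      2 * (𝟙 (w Fin.<? u) * 𝟙 (s w Fin.<? s u)) + 0  ∎
      where
      open ≡-Reasoning
      same-order : 𝟙 (s w Fin.<? s u) ≡ 𝟙 (w Fin.<? u)
      same-order = 𝟙-cong (λ sw<su → s-reflects sw<su ¬vv') (λ w<u → s-monotone w<u ¬v'v) _ _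

    module _ (σ : Fin n → Fin n) (σ-perm : IsPerm σ) where

      x y : Fin n
      x = perm-inverse σ σ-perm v
      y = perm-inverse σ σ-perm v'

      exceptional-positions : ∀ i j →
        exceptional (σ i) (σ j) ≡ 𝟙 ((i Fin.≟ x) ×-dec (j Fin.≟ y)) + 𝟙 ((i Fin.≟ y) ×-dec (j Fin.≟ x))
      exceptional-positions i j = cong₂ _+_ (at (perm-inverseʳ σ σ-perm v) (perm-inverseʳ σ σ-perm v'))
                                            (at (perm-inverseʳ σ σ-perm v') (perm-inverseʳ σ σ-perm v))
        where
        at : ∀ {a b z z'} → σ z ≡ a → σ z' ≡ b →
             𝟙 ((σ i Fin.≟ a) ×-dec (σ j Fin.≟ b)) ≡ 𝟙 ((i Fin.≟ z) ×-dec (j Fin.≟ z'))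
        at {z = z} {z'} σz σz' = 𝟙-cong
          (λ (p , q) → σ-perm i z (trans p (sym σz)) , σ-perm j z' (trans q (sym σz')))
          (λ { (refl , refl) → σz , σz' }) _ _

      -- Exactly one of the two orderings of {x , y} is a pair of positions i < j.
      exceptional-sum : sum₂ (λ i j → 𝟙 (i Fin.<? j) * exceptional (σ i) (σ j)) ≡ 1
      exceptional-sum = begin
        sum₂ (λ i j → ord i j * exceptional (σ i) (σ j))
          ≡⟨ sum₂-cong (λ i j → trans (cong (ord i j *_) (exceptional-positions i j)) (ℕₚ.*-distribˡ-+ (ord i j) _ _)) ⟩
        sum₂ (λ i j → ord i j * 𝟙 ((i Fin.≟ x) ×-dec (j Fin.≟ y)) + ord i j * 𝟙 ((i Fin.≟ y) ×-dec (j Fin.≟ x)))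
          ≡⟨ sum₂-+ (λ i j → ord i j * 𝟙 ((i Fin.≟ x) ×-dec (j Fin.≟ y))) (λ i j → ord i j * 𝟙 ((i Fin.≟ y) ×-dec (j Fin.≟ x))) ⟩
        sum₂ (λ i j → ord i j * 𝟙 ((i Fin.≟ x) ×-dec (j Fin.≟ y))) + sum₂ (λ i j → ord i j * 𝟙 ((i Fin.≟ y) ×-dec (j Fin.≟ x)))
          ≡⟨ cong₂ _+_ (sum₂-point x y ord) (sum₂-point y x ord) ⟩
        ord x y + ord y x
          ≡⟨ 𝟙-<-total x≢y ⟩
        1 ∎
        where
        open ≡-Reasoning
        ord : Fin n → Fin n → ℕ
        ord i j = 𝟙 (i Fin.<? j)
        x≢y : x ≢ y
        x≢y x≡y = v≢v' (trans (sym (perm-inverseʳ σ σ-perm v)) (trans (cong σ x≡y) (perm-inverseʳ σ σ-perm v')))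

      invertedBoth : Fin n → Fin n → ℕ
      invertedBoth i j = 𝟙 (i Fin.<? j) * (𝟙 (σ j Fin.<? σ i) * 𝟙 (s (σ j) Fin.<? s (σ i)))

      inversions-swap-adjacent : inversions (s ∘ σ) + inversions σ ≡ 2 * sum₂ invertedBoth + 1
      inversions-swap-adjacent = begin
        inversions (s ∘ σ) + inversions σ
          ≡⟨ cong₂ _+_ (inversions-sum (s ∘ σ)) (inversions-sum σ) ⟩
        sum₂ (inverted (s ∘ σ)) + sum₂ (inverted σ)
          ≡⟨ sum₂-+ (inverted (s ∘ σ)) (inverted σ) ⟨
        sum₂ (λ i j → inverted (s ∘ σ) i j + inverted σ i j)
          ≡⟨ sum₂-cong pairwise ⟩
        sum₂ (λ i j → 2 * invertedBoth i j + 𝟙 (i Fin.<? j) * exceptional (σ i) (σ j))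
          ≡⟨ sum₂-+ (λ i j → 2 * invertedBoth i j) (λ i j → 𝟙 (i Fin.<? j) * exceptional (σ i) (σ j)) ⟩
        sum₂ (λ i j → 2 * invertedBoth i j) + sum₂ (λ i j → 𝟙 (i Fin.<? j) * exceptional (σ i) (σ j))
          ≡⟨ cong₂ _+_ (sum₂-*ˡ 2 invertedBoth) exceptional-sum ⟩
        2 * sum₂ invertedBoth + 1 ∎
        where
        open ≡-Reasoning
        distribute : ∀ l a e → l * (2 * a + e) ≡ 2 * (l * a) + l * e
        distribute = solve-∀
        pairwise : ∀ i j → inverted (s ∘ σ) i j + inverted σ i j ≡ 2 * invertedBoth i j + 𝟙 (i Fin.<? j) * exceptional (σ i) (σ j)
        pairwise i j = begin
          ord * 𝟙 (s (σ j) Fin.<? s (σ i)) + ord * 𝟙 (σ j Fin.<? σ i)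
            ≡⟨ ℕₚ.*-distribˡ-+ ord _ _ ⟨
          ord * (𝟙 (s (σ j) Fin.<? s (σ i)) + 𝟙 (σ j Fin.<? σ i))
            ≡⟨ cong (ord *_) (pair-identity (σ i) (σ j)) ⟩
          ord * (2 * (𝟙 (σ j Fin.<? σ i) * 𝟙 (s (σ j) Fin.<? s (σ i))) + exceptional (σ i) (σ j))
            ≡⟨ distribute ord _ _ ⟩
          2 * invertedBoth i j + ord * exceptional (σ i) (σ j) ∎
          where
          ord : ℕ
          ord = 𝟙 (i Fin.<? j)

open Permutations

module Signs {c ℓ : Level} (K : CommutativeRing c ℓ) where

  open CommutativeRing K renaming (refl to ≈-refl)
  open RingProperties ring using (-‿distribˡ-*; -‿involutive; -1*x≈-x)
  open SetoidReasoning setoid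

  signPow-+ : ∀ a b → signPow K (a Nat.+ b) ≈ signPow K a * signPow K b
  signPow-+ zero    b = sym (*-identityˡ _)
  signPow-+ (suc a) b = trans (-‿cong (signPow-+ a b)) (-‿distribˡ-* (signPow K a) (signPow K b))

  signPow-square : ∀ a → signPow K a * signPow K a ≈ 1#
  signPow-square zero    = *-identityˡ 1#
  signPow-square (suc a) = begin
    - signPow K a * - signPow K a     ≈⟨ -‿distribˡ-* (signPow K a) (- signPow K a) ⟨
    - (signPow K a * - signPow K a)   ≈⟨ -‿cong (*-comm (signPow K a) (- signPow K a)) ⟩
    - (- signPow K a * signPow K a)   ≈⟨ -‿cong (-‿distribˡ-* (signPow K a) (signPow K a)) ⟨
    - - (signPow K a * signPow K a)   ≈⟨ -‿involutive _ ⟩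
    signPow K a * signPow K a         ≈⟨ signPow-square a ⟩
    1#                                ∎

  signPow-odd-sum : ∀ a b m → a Nat.+ b ≡ suc (m Nat.+ m) → signPow K a ≈ - signPow K b
  signPow-odd-sum a b m a+b≡odd = begin
    signPow K a                                     ≈⟨ *-identityʳ _ ⟨
    signPow K a * 1#                                ≈⟨ *-congˡ (signPow-square b) ⟨
    signPow K a * (signPow K b * signPow K b)       ≈⟨ *-assoc _ _ _ ⟨
    signPow K a * signPow K b * signPow K b         ≈⟨ *-congʳ (signPow-+ a b) ⟨
    signPow K (a Nat.+ b) * signPow K b             ≡⟨ ≡.cong (λ e → signPow K e * signPow K b) a+b≡odd ⟩
    - signPow K (m Nat.+ m) * signPow K b           ≈⟨ *-congʳ (-‿cong (trans (signPow-+ m m) (signPow-square m))) ⟩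
    - 1# * signPow K b                              ≈⟨ -1*x≈-x _ ⟩
    - signPow K b                                   ∎

  sgn-cong : ∀ {n} {σ τ : Fin n → Fin n} → (∀ i → σ i ≡ τ i) → sgn K σ ≡ sgn K τ
  sgn-cong σ≗τ = ≡.cong (signPow K) (inversions-cong σ≗τ)

  sgn-id : ∀ n → sgn K {n} id ≡ 1#
  sgn-id n = ≡.cong (signPow K) (inversions-id n)

  sgn-swap-adjacent : ∀ {n} {v v' : Fin n} → toℕ v' ≡ suc (toℕ v) →
                      (σ : Fin n → Fin n) → IsPerm σ → sgn K (swap v v' ∘ σ) ≈ - sgn K σ
  sgn-swap-adjacent {v = v} {v'} v'≡1+v σ σ-perm =
    signPow-odd-sum (inversions (swap v v' ∘ σ)) (inversions σ) m
                    (≡.trans (inversions-swap-adjacent σ σ-perm) (twice-plus-one m))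
    where
    open AdjacentSwap v v' v'≡1+v
    m : ℕ
    m = sum₂ (invertedBoth σ σ-perm)
    twice-plus-one : ∀ m → 2 Nat.* m Nat.+ 1 ≡ suc (m Nat.+ m)
    twice-plus-one = solve-∀

  -- A transposition (a b) with b = a + 1 + d is a conjugate of (a+1 b) by (a a+1);
  -- induction on d reduces it to adjacent transpositions.
  sgn-swap-< : ∀ {n} d {a b : Fin n} → toℕ b ≡ toℕ a Nat.+ suc d →
               (σ : Fin n → Fin n) → IsPerm σ → sgn K (swap a b ∘ σ) ≈ - sgn K σ
  sgn-swap-< zero    {a} {b} b≡a+1 σ σ-perm = sgn-swap-adjacent (≡.trans b≡a+1 (ℕₚ.+-comm (toℕ a) 1)) σ σ-perm
  sgn-swap-< {n} (suc d) {a} {b} b≡a+2+d σ σ-perm = begin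
    sgn K (swap a b ∘ σ)                         ≡⟨ sgn-cong (swap-conjugate a≢a' a≢b a'≢b ∘ σ) ⟩
    sgn K (swap a a' ∘ (swap a' b ∘ τ))          ≈⟨ sgn-swap-adjacent a'≡1+a _ (IsPerm-∘ (swap-IsPerm a' b) τ-perm) ⟩
    - sgn K (swap a' b ∘ τ)                      ≈⟨ -‿cong (sgn-swap-< d b≡a'+1+d τ τ-perm) ⟩
    - - sgn K τ                                  ≈⟨ -‿involutive _ ⟩
    sgn K τ                                      ≈⟨ sgn-swap-adjacent a'≡1+a σ σ-perm ⟩
    - sgn K σ                                    ∎
    where
    1+a<b : suc (toℕ a) < toℕ b
    1+a<b = ≡.subst (suc (toℕ a) <_) (≡.sym (≡.trans b≡a+2+d (≡.trans (ℕₚ.+-suc (toℕ a) (suc d)) (≡.cong suc (ℕₚ.+-suc (toℕ a) d)))))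
                    (s≤s (s≤s (ℕₚ.m≤m+n (toℕ a) d)))
    a' : Fin n
    a' = Fin.fromℕ< (ℕₚ.<-trans 1+a<b (Finₚ.toℕ<n b))
    a'≡1+a : toℕ a' ≡ suc (toℕ a)
    a'≡1+a = Finₚ.toℕ-fromℕ< _
    b≡a'+1+d : toℕ b ≡ toℕ a' Nat.+ suc d
    b≡a'+1+d = ≡.trans b≡a+2+d (≡.trans (ℕₚ.+-suc (toℕ a) (suc d)) (≡.cong (Nat._+ suc d) (≡.sym a'≡1+a)))
    τ : Fin n → Fin n
    τ = swap a a' ∘ σ
    τ-perm : IsPerm τ
    τ-perm = IsPerm-∘ (swap-IsPerm a a') σ-perm
    a≢a' : a ≢ a'
    a≢a' a≡a' = ℕₚ.<-irrefl (≡.trans (≡.cong toℕ a≡a') a'≡1+a) (ℕₚ.n<1+n _)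
    a≢b : a ≢ b
    a≢b a≡b = ℕₚ.<-irrefl (≡.cong toℕ a≡b) (ℕₚ.<-trans (ℕₚ.n<1+n _) 1+a<b)
    a'≢b : a' ≢ b
    a'≢b a'≡b = ℕₚ.<-irrefl (≡.trans (≡.sym a'≡1+a) (≡.cong toℕ a'≡b)) 1+a<b

  sgn-swap : ∀ {n} {a b : Fin n} → a ≢ b → (σ : Fin n → Fin n) → IsPerm σ → sgn K (swap a b ∘ σ) ≈ - sgn K σ
  sgn-swap {a = a} {b} a≢b σ σ-perm with ℕₚ.<-cmp (toℕ a) (toℕ b)
  ... | tri< a<b _ _ = let d , a+d≡b = ℕₚ.m≤n⇒∃[o]m+o≡n a<b in
    sgn-swap-< d (≡.sym (≡.trans (ℕₚ.+-suc (toℕ a) d) a+d≡b)) σ σ-perm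
  ... | tri≈ _ a≡b _ = ⊥-elim (a≢b (Finₚ.toℕ-injective a≡b))
  ... | tri> _ _ b<a = let d , b+d≡a = ℕₚ.m≤n⇒∃[o]m+o≡n b<a in begin
    sgn K (swap a b ∘ σ)   ≡⟨ sgn-cong (swap-comm a b ∘ σ) ⟩
    sgn K (swap b a ∘ σ)   ≈⟨ sgn-swap-< d (≡.sym (≡.trans (ℕₚ.+-suc (toℕ b) d) b+d≡a)) σ σ-perm ⟩
    - sgn K σ              ∎

allFuns-complete : ∀ n m (h : Fin n → Fin m) → ∃ λ h' → h' ∈ allFuns n m × (∀ i → h' i ≡ h i)
allFuns-complete zero    m h = (λ ()) , here refl , λ ()
allFuns-complete (suc n) m h with allFuns-complete n m (h ∘ Fin.suc)
... | h' , h'∈ , h'≗h = (h Fin.zero ∷ᶠ h')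
                      , Memₚ.∈-concatMap⁺ (λ a → map (a ∷ᶠ_) (allFuns n m)) (lose (Memₚ.∈-allFin (h Fin.zero)) (Memₚ.∈-map⁺ (h Fin.zero ∷ᶠ_) h'∈))
                      , λ { Fin.zero → refl ; (Fin.suc i) → h'≗h i }

module Indicator {c ℓ : Level} (K : CommutativeRing c ℓ) where

  open CommutativeRing K using (0#; 1#)

  indicator-≗ : ∀ {n m} {f g : Fin n → Fin m} → (∀ i → f i ≡ g i) → indicator K f g ≡ 1#
  indicator-≗ {f = f} {g} f≗g rewrite dec-true (f ≟fun g) f≗g = refl

  indicator-≭ : ∀ {n m} {f g : Fin n → Fin m} → ¬ (∀ i → f i ≡ g i) → indicator K f g ≡ 0#
  indicator-≭ {f = f} {g} f≭g rewrite dec-false (f ≟fun g) f≭g = refl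

  indicator-congˡ : ∀ {n m} {f f' : Fin n → Fin m} (g : Fin n → Fin m) → (∀ i → f i ≡ f' i) → indicator K f g ≡ indicator K f' g
  indicator-congˡ {f = f} {f'} g f≗f' = by-cases (f' ≟fun g)
    where
    by-cases : Dec (∀ i → f' i ≡ g i) → indicator K f g ≡ indicator K f' g
    by-cases (yes f'≗g) = ≡.trans (indicator-≗ (λ i → ≡.trans (f≗f' i) (f'≗g i))) (≡.sym (indicator-≗ f'≗g))
    by-cases (no f'≭g)  = ≡.trans (indicator-≭ (λ f≗g → f'≭g (λ i → ≡.trans (≡.sym (f≗f' i)) (f≗g i))))
                                  (≡.sym (indicator-≭ f'≭g))

module ListSums {c ℓ : Level} (K : CommutativeRing c ℓ) where

  open CommutativeRing K renaming (refl to ≈-refl)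
  open RingProperties ring using (-0#≈0#; -‿+-comm)
  open SetoidReasoning setoid
  module KΣ = SemiringSum semiring

  sumK-cong : ∀ {a} {A : Set a} {F G : A → Carrier} (xs : List A) → (∀ x → F x ≈ G x) →
              sumK K (map F xs) ≈ sumK K (map G xs)
  sumK-cong []       F≈G = ≈-refl
  sumK-cong (x ∷ xs) F≈G = +-cong (F≈G x) (sumK-cong xs F≈G)

  sumK-++ : ∀ xs ys → sumK K (xs ++ ys) ≈ sumK K xs + sumK K ys
  sumK-++ []       ys = sym (+-identityˡ _)
  sumK-++ (x ∷ xs) ys = trans (+-congˡ (sumK-++ xs ys)) (sym (+-assoc _ _ _))

  sumK-concatMap : ∀ {a} {A : Set a} (F : A → List Carrier) (xs : List A) →
                   sumK K (concatMap F xs) ≈ sumK K (map (sumK K ∘ F) xs)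
  sumK-concatMap F []       = ≈-refl
  sumK-concatMap F (x ∷ xs) = trans (sumK-++ (F x) (concatMap F xs)) (+-congˡ (sumK-concatMap F xs))

  onlyIf : ∀ {p} {P : Set p} → Dec P → Carrier → Carrier
  onlyIf (yes _) x = x
  onlyIf (no _)  _ = 0#

  onlyIf-cong : ∀ {p q} {P : Set p} {Q : Set q} (dP : Dec P) (dQ : Dec Q) → (P → Q) → (Q → P) →
                ∀ {x y} → (P → x ≈ y) → onlyIf dP x ≈ onlyIf dQ y
  onlyIf-cong (yes p) (yes _) _   _   x≈y = x≈y p
  onlyIf-cong (yes p) (no ¬q) P→Q _   _   = ⊥-elim (¬q (P→Q p))
  onlyIf-cong (no ¬p) (yes q) _   Q→P _   = ⊥-elim (¬p (Q→P q))
  onlyIf-cong (no _)  (no _)  _   _   _   = ≈-refl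

  onlyIf-negate : ∀ {p q} {P : Set p} {Q : Set q} (dP : Dec P) (dQ : Dec Q) → (P → Q) → (Q → P) →
                  ∀ {x y} → (P → x ≈ - y) → onlyIf dP x ≈ - onlyIf dQ y
  onlyIf-negate (yes p) (yes _) _   _   x≈-y = x≈-y p
  onlyIf-negate (yes p) (no ¬q) P→Q _   _    = ⊥-elim (¬q (P→Q p))
  onlyIf-negate (no ¬p) (yes q) _   Q→P _    = ⊥-elim (¬p (Q→P q))
  onlyIf-negate (no _)  (no _)  _   _   _    = sym -0#≈0#

  sumK-filter : ∀ {a p} {A : Set a} {P : Pred A p} (P? : Decidable P) (F : A → Carrier) (xs : List A) →
                sumK K (map F (filter P? xs)) ≈ sumK K (map (λ x → onlyIf (P? x) (F x)) xs)
  sumK-filter P? F []       = ≈-refl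
  sumK-filter P? F (x ∷ xs) with P? x
  ... | yes _ = +-congˡ (sumK-filter P? F xs)
  ... | no _  = trans (sumK-filter P? F xs) (sym (+-identityˡ _))

  sumK-zero : ∀ {a} {A : Set a} {F : A → Carrier} (xs : List A) → (∀ x → F x ≈ 0#) → sumK K (map F xs) ≈ 0#
  sumK-zero []       F≈0 = ≈-refl
  sumK-zero (x ∷ xs) F≈0 = trans (+-cong (F≈0 x) (sumK-zero xs F≈0)) (+-identityˡ 0#)

  sumK-neg : ∀ {a} {A : Set a} (F : A → Carrier) (xs : List A) → sumK K (map (λ x → - F x) xs) ≈ - sumK K (map F xs)
  sumK-neg F []       = sym -0#≈0#
  sumK-neg F (x ∷ xs) = trans (+-congˡ (sumK-neg F xs)) (-‿+-comm _ _)

  sumK-tabulate : ∀ {m} (G : Fin m → Carrier) → sumK K (tabulate G) ≈ KΣ.sum G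
  sumK-tabulate {zero}  G = ≈-refl
  sumK-tabulate {suc m} G = +-congˡ (sumK-tabulate (G ∘ Fin.suc))

  sumK-allFin : ∀ {m} (G : Fin m → Carrier) → sumK K (map G (allFin m)) ≈ KΣ.sum G
  sumK-allFin G = trans (reflexive (≡.cong (sumK K) (Listₚ.map-tabulate id G))) (sumK-tabulate G)

  sumK-allFin-reindex : ∀ {m} (t : Fin m → Fin m) → IsPerm t → (G : Fin m → Carrier) →
                        sumK K (map (G ∘ t) (allFin m)) ≈ sumK K (map G (allFin m))
  sumK-allFin-reindex t t-perm G = begin
    sumK K (map (G ∘ t) (allFin _))  ≈⟨ sumK-allFin (G ∘ t) ⟩
    KΣ.sum (G ∘ t)                   ≈⟨ KΣ.sum-permute G (toPermutation t t-perm) ⟨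
    KΣ.sum G                         ≈⟨ sumK-allFin G ⟨
    sumK K (map G (allFin _))        ∎

  sumK-allFuns-suc : ∀ {n m} (H : (Fin (suc n) → Fin m) → Carrier) →
    sumK K (map H (allFuns (suc n) m)) ≈ sumK K (map (λ a → sumK K (map (λ f → H (a ∷ᶠ f)) (allFuns n m))) (allFin m))
  sumK-allFuns-suc {n} {m} H = begin
    sumK K (map H (concatMap (λ a → map (a ∷ᶠ_) (allFuns n m)) (allFin m)))
      ≡⟨ ≡.cong (sumK K) (Listₚ.map-concatMap H (λ a → map (a ∷ᶠ_) (allFuns n m)) (allFin m)) ⟩
    sumK K (concatMap (λ a → map H (map (a ∷ᶠ_) (allFuns n m))) (allFin m))
      ≈⟨ sumK-concatMap (λ a → map H (map (a ∷ᶠ_) (allFuns n m))) (allFin m) ⟩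
    sumK K (map (λ a → sumK K (map H (map (a ∷ᶠ_) (allFuns n m)))) (allFin m))
      ≈⟨ sumK-cong (allFin m) (λ a → reflexive (≡.cong (sumK K) (≡.sym (Listₚ.map-∘ (allFuns n m))))) ⟩
    sumK K (map (λ a → sumK K (map (λ f → H (a ∷ᶠ f)) (allFuns n m))) (allFin m)) ∎

  Extensional : ∀ {n m} → ((Fin n → Fin m) → Carrier) → Set ℓ
  Extensional {n} H = ∀ h h' → (∀ (i : Fin n) → h i ≡ h' i) → H h ≈ H h'

  sumK-allFuns-reindex : ∀ n m (t : Fin m → Fin m) → IsPerm t → (H : (Fin n → Fin m) → Carrier) → Extensional H →
                         sumK K (map (λ h → H (t ∘ h)) (allFuns n m)) ≈ sumK K (map H (allFuns n m))
  sumK-allFuns-reindex zero    m t t-perm H H-ext = +-congʳ (H-ext _ _ (λ ()))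
  sumK-allFuns-reindex (suc n) m t t-perm H H-ext = begin
    sumK K (map (λ h → H (t ∘ h)) (allFuns (suc n) m))
      ≈⟨ sumK-allFuns-suc (λ h → H (t ∘ h)) ⟩
    sumK K (map (λ a → sumK K (map (λ f → H (t ∘ (a ∷ᶠ f))) (allFuns n m))) (allFin m))
      ≈⟨ sumK-cong (allFin m) (λ a → sumK-cong (allFuns n m) (λ f → H-ext _ _ (λ { Fin.zero → refl ; (Fin.suc i) → refl }))) ⟩
    sumK K (map (λ a → sumK K (map (λ f → H (t a ∷ᶠ (t ∘ f))) (allFuns n m))) (allFin m))
      ≈⟨ sumK-cong (allFin m) (λ a → sumK-allFuns-reindex n m t t-perm (λ f → H (t a ∷ᶠ f))
                                       (λ h h' h≗h' → H-ext _ _ (λ { Fin.zero → refl ; (Fin.suc i) → h≗h' i }))) ⟩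
    sumK K (map (λ a → sumK K (map (λ f → H (t a ∷ᶠ f)) (allFuns n m))) (allFin m))
      ≈⟨ sumK-allFin-reindex t t-perm (λ a → sumK K (map (λ f → H (a ∷ᶠ f)) (allFuns n m))) ⟩
    sumK K (map (λ a → sumK K (map (λ f → H (a ∷ᶠ f)) (allFuns n m))) (allFin m))
      ≈⟨ sumK-allFuns-suc H ⟨
    sumK K (map H (allFuns (suc n) m)) ∎

module CharacteristicZero {c ℓ : Level} (K : CommutativeRing c ℓ) where

  open CommutativeRing K renaming (refl to ≈-refl)
  open SetoidReasoning setoid

  Natural Positive : Carrier → Set ℓ
  Natural  x = ∃ λ m → x ≈ natK K m
  Positive x = ∃ λ m → x ≈ natK K (suc m)

  Natural-resp : ∀ {x y} → x ≈ y → Natural y → Natural x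
  Natural-resp x≈y (m , y≈m) = m , trans x≈y y≈m

  Positive-resp : ∀ {x y} → x ≈ y → Positive y → Positive x
  Positive-resp x≈y (m , y≈m) = m , trans x≈y y≈m

  natural-0 : Natural 0#
  natural-0 = 0 , ≈-refl

  positive-1 : Positive 1#
  positive-1 = 0 , sym (+-identityʳ 1#)

  positive⇒natural : ∀ {x} → Positive x → Natural x
  positive⇒natural (m , x≈1+m) = suc m , x≈1+m

  natK-+ : ∀ a b → natK K (a Nat.+ b) ≈ natK K a + natK K b
  natK-+ zero    b = sym (+-identityˡ _)
  natK-+ (suc a) b = trans (+-congˡ (natK-+ a b)) (sym (+-assoc _ _ _))

  natural-sum : ∀ {a} {A : Set a} (F : A → Carrier) xs → (∀ {x} → x ∈ xs → Natural (F x)) → Natural (sumK K (map F xs))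
  natural-sum F []       nat = natural-0
  natural-sum F (x ∷ xs) nat with nat (here refl) | natural-sum F xs (nat ∘ there)
  ... | a , Fx≈a | b , Σ≈b = a Nat.+ b , trans (+-cong Fx≈a Σ≈b) (sym (natK-+ a b))

  positive-sum : ∀ {a} {A : Set a} (F : A → Carrier) xs → (∀ {x} → x ∈ xs → Natural (F x)) →
                 ∀ {y} → y ∈ xs → Positive (F y) → Positive (sumK K (map F xs))
  positive-sum F (x ∷ xs) nat (here refl) (a , Fx≈1+a) with natural-sum F xs (nat ∘ there)
  ... | b , Σ≈b = a Nat.+ b , trans (+-cong Fx≈1+a Σ≈b) (sym (natK-+ (suc a) b))
  positive-sum F (x ∷ xs) nat (there y∈xs) pos with nat (here refl) | positive-sum F xs (nat ∘ there) y∈xs pos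
  ... | a , Fx≈a | b , Σ≈1+b = a Nat.+ b , trans (+-cong Fx≈a Σ≈1+b)
                                             (trans (sym (natK-+ a (suc b))) (reflexive (≡.cong (natK K) (ℕₚ.+-suc a b))))

  positive≉0 : CharZero K → ∀ {x} → Positive x → ¬ (x ≈ 0#)
  positive≉0 char0 (m , x≈1+m) x≈0 = ℕₚ.1+n≢0 (char0 (suc m) (trans (sym x≈1+m) x≈0))

  -- In a field of characteristic zero 2 is invertible, so x = -x only for x = 0.
  x≈-x⇒x≈0 : IsField K → CharZero K → ∀ x → x ≈ - x → x ≈ 0#
  x≈-x⇒x≈0 (_ , inverse) char0 x x≈-x = begin
    x               ≈⟨ *-identityˡ x ⟨
    1# * x          ≈⟨ *-congʳ (trans (*-comm half two) (proj₂ two⁻¹)) ⟨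
    (half * two) * x ≈⟨ *-assoc half two x ⟩
    half * (two * x) ≈⟨ *-congˡ two-x≈0 ⟩
    half * 0#       ≈⟨ zeroʳ half ⟩
    0#              ∎
    where
    two : Carrier
    two = natK K 2
    two⁻¹ : ∃ λ y → two * y ≈ 1#
    two⁻¹ = inverse two (ℕₚ.1+n≢0 ∘ char0 2)
    half : Carrier
    half = proj₁ two⁻¹
    two-x≈0 : two * x ≈ 0#
    two-x≈0 = begin
      (1# + (1# + 0#)) * x  ≈⟨ *-congʳ (+-congˡ (+-identityʳ 1#)) ⟩
      (1# + 1#) * x         ≈⟨ distribʳ x 1# 1# ⟩
      1# * x + 1# * x       ≈⟨ +-cong (*-identityˡ x) (*-identityˡ x) ⟩
      x + x                 ≈⟨ +-congˡ x≈-x ⟩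
      x + - x               ≈⟨ -‿inverseʳ x ⟩
      0#                    ∎

lookup-injective : ∀ {a} {A : Set a} (xs : List A) → Unique xs → ∀ i j → lookup xs i ≡ lookup xs j → i ≡ j
lookup-injective (x ∷ xs) u             Fin.zero    Fin.zero    eq = refl
lookup-injective (x ∷ xs) (x∉xs ∷ u)    Fin.zero    (Fin.suc j) eq = ⊥-elim (All.lookup x∉xs (Memₚ.∈-lookup j) eq)
lookup-injective (x ∷ xs) (x∉xs ∷ u)    (Fin.suc i) Fin.zero    eq = ⊥-elim (All.lookup x∉xs (Memₚ.∈-lookup i) (≡.sym eq))
lookup-injective (x ∷ xs) (_ ∷ u)       (Fin.suc i) (Fin.suc j) eq = ≡.cong Fin.suc (lookup-injective xs u i j eq)

module ColumnRank (D : List Cell) (D-unique : Unique D) where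

  open Nat using (_*_)
  open ≡ using (sym; trans; cong; cong₂; subst; subst₂; module ≡-Reasoning)

  n : ℕ
  n = length D

  R C : Fin n → ℤ
  R i = row (cell D i)
  C i = col (cell D i)

  cell-injective : ∀ {i j} → R i ≡ R j → C i ≡ C j → i ≡ j
  cell-injective Ri≡Rj Ci≡Cj = lookup-injective D D-unique _ _ (cong₂ _,_ Ri≡Rj Ci≡Cj)

  above : Fin n → Fin n → ℕ
  above i j = 𝟙 (C i Int.≟ C j) * 𝟙 (R i Intₚ.<? R j)

  rank : Fin n → ℕ
  rank j = sum (λ i → above i j)

  𝟙-<-mono : ∀ {x y z} → y Int.≤ z → 𝟙 (x Intₚ.<? y) ≤ 𝟙 (x Intₚ.<? z)
  𝟙-<-mono {x} {y} {z} y≤z with x Intₚ.<? y | x Intₚ.<? z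
  ... | yes _   | yes _   = ℕₚ.≤-refl
  ... | yes x<y | no x≮z  = ⊥-elim (x≮z (Intₚ.<-≤-trans x<y y≤z))
  ... | no _    | _       = z≤n

  above-mono : ∀ {a b} → C a ≡ C b → R a Int.≤ R b → ∀ i → above i a ≤ above i b
  above-mono {a} {b} Ca≡Cb Ra≤Rb i = subst (λ c → above i a ≤ 𝟙 (C i Int.≟ c) * 𝟙 (R i Intₚ.<? R b)) Ca≡Cb
    (ℕₚ.*-monoʳ-≤ (𝟙 (C i Int.≟ C a)) (𝟙-<-mono Ra≤Rb))

  not-above-self : ∀ a → above a a ≡ 0
  not-above-self a = trans (cong (𝟙 (C a Int.≟ C a) *_) (𝟙-no (R a Intₚ.<? R a) (Intₚ.<-irrefl refl))) (ℕₚ.*-zeroʳ (𝟙 (C a Int.≟ C a)))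

  above-self<above : ∀ {a b} → C a ≡ C b → R a Int.< R b → above a a < above a b
  above-self<above {a} {b} Ca≡Cb Ra<Rb =
    subst₂ _<_ (sym (not-above-self a)) (sym (cong₂ _*_ (𝟙-yes (C a Int.≟ C b) Ca≡Cb) (𝟙-yes (R a Intₚ.<? R b) Ra<Rb))) (s≤s z≤n)

  rank-mono : ∀ {a b} → C a ≡ C b → R a Int.≤ R b → rank a ≤ rank b
  rank-mono Ca≡Cb Ra≤Rb = sum-mono-≤ (above-mono Ca≡Cb Ra≤Rb)

  rank-strict : ∀ {a b} → C a ≡ C b → R a Int.< R b → rank a < rank b
  rank-strict {a} Ca≡Cb Ra<Rb = sum-mono-< (above-mono Ca≡Cb (Intₚ.<⇒≤ Ra<Rb)) a (above-self<above Ca≡Cb Ra<Rb)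

  rank-injective : ∀ {a b} → C a ≡ C b → rank a ≡ rank b → a ≡ b
  rank-injective {a} {b} Ca≡Cb ra≡rb with Intₚ.<-cmp (R a) (R b)
  ... | tri< Ra<Rb _ _ = ⊥-elim (ℕₚ.<-irrefl ra≡rb (rank-strict Ca≡Cb Ra<Rb))
  ... | tri≈ _ Ra≡Rb _ = cell-injective Ra≡Rb Ca≡Cb
  ... | tri> _ _ Rb<Ra = ⊥-elim (ℕₚ.<-irrefl (sym ra≡rb) (rank-strict (sym Ca≡Cb) Rb<Ra))

  rank<columnSize : ∀ j → rank j < columnSize D (C j)
  rank<columnSize j = ℕₚ.<-≤-trans
    (sum-mono-< (λ i → ℕₚ.≤-trans (ℕₚ.*-monoʳ-≤ (𝟙 (C i Int.≟ C j)) (𝟙≤1 (R i Intₚ.<? R j))) (ℕₚ.≤-reflexive (ℕₚ.*-identityʳ _)))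
                j self<1)
    (ℕₚ.≤-reflexive (sym (count-lookup (λ x → col x Int.≟ C j) D)))
    where
    self<1 : above j j < 𝟙 (C j Int.≟ C j)
    self<1 = subst₂ _<_ (sym (not-above-self j)) (sym (𝟙-yes (C j Int.≟ C j) refl)) (s≤s z≤n)

  -- The number of cells in strictly higher rows, the measure for the rigidity induction.
  height : Fin n → ℕ
  height j = sum (λ i → 𝟙 (R i Intₚ.<? R j))

  height-strict : ∀ {a b} → R a Int.< R b → height a < height b
  height-strict {a} {b} Ra<Rb = sum-mono-< (λ i → 𝟙-<-mono (Intₚ.<⇒≤ Ra<Rb)) a
    (subst₂ _<_ (sym (𝟙-no (R a Intₚ.<? R a) (Intₚ.<-irrefl refl))) (sym (𝟙-yes (R a Intₚ.<? R b) Ra<Rb)) (s≤s z≤n))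

  module Rigidity (p q : Fin n → Fin n) (p-perm : IsPerm p) (q-perm : IsPerm q)
                  (p-rows : ∀ i → R (p i) ≡ R i) (q-cols : ∀ i → C (q i) ≡ C i)
                  (rank-preserved : ∀ i → rank (q (p i)) ≡ rank i) where

    -- If q fixes every cell in the rows above r, it also fixes row r: on row r it can
    -- only increase ranks, while p permutes row r, so the total rank of row r is unchanged.
    fixes-row : ∀ r → (∀ i → R i Int.< r → q i ≡ i) → ∀ j → R j ≡ r → q j ≡ j
    fixes-row r fixed-above j Rj≡r = rank-injective (q-cols j) (sym (rank-kept j Rj≡r))
      where
      rank-grows : ∀ i → R i ≡ r → rank i ≤ rank (q i)
      rank-grows i Ri≡r with R (q i) Intₚ.<? r
      ... | yes Rqi<r = ℕₚ.≤-reflexive (cong rank (sym (q-perm (q i) i (fixed-above (q i) Rqi<r))))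
      ... | no Rqi≮r  = rank-mono (sym (q-cols i)) (subst (Int._≤ R (q i)) (sym Ri≡r) (Intₚ.≮⇒≥ Rqi≮r))
      inRow : Fin n → ℕ
      inRow i = 𝟙 (R i Int.≟ r)
      before after : Fin n → ℕ
      before i = inRow i * rank i
      after  i = inRow i * rank (q i)
      before≤after : ∀ i → before i ≤ after i
      before≤after i with R i Int.≟ r
      ... | yes Ri≡r = ℕₚ.+-monoˡ-≤ 0 (rank-grows i Ri≡r)
      ... | no _     = z≤n
      totals : sum before ≡ sum after
      totals = begin
        sum before        ≡⟨ sum-cong-≗ (λ i → cong₂ (λ ρ κ → 𝟙 (ρ Int.≟ r) * κ) (p-rows i) (rank-preserved i)) ⟨
        sum (after ∘ p)   ≡⟨ sum-reindex p p-perm after ⟩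
        sum after         ∎
        where open ≡-Reasoning
      rank-kept : ∀ i → R i ≡ r → rank i ≡ rank (q i)
      rank-kept i Ri≡r with sum-≤-rigid before≤after totals i
      ... | before≡after rewrite 𝟙-yes (R i Int.≟ r) Ri≡r = ℕₚ.+-cancelʳ-≡ _ _ _ before≡after

    fixed-below-height : ∀ m j → height j < m → q j ≡ j
    fixed-below-height (suc m) j hj<1+m = fixes-row (R j)
      (λ i Ri<Rj → fixed-below-height m i (ℕₚ.<-≤-trans (height-strict Ri<Rj) (ℕₚ.≤-pred hj<1+m))) j refl

    q-identity : ∀ j → q j ≡ j
    q-identity j = fixed-below-height (suc (height j)) j ℕₚ.≤-refl

inColumn? : (D : List Cell) (c : ℤ) (i : Fin (length D)) → Dec (col (cell D i) ≡ c)
inColumn? D c i = col (cell D i) Int.≟ c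

columnCells : (D : List Cell) → ℤ → List (Fin (length D))
columnCells D c = filter (inColumn? D c) (allFin (length D))

columnCells-length : ∀ D c → length (columnCells D c) ≡ columnSize D c
columnCells-length D c = ≡.trans (count-tabulate (inColumn? D c) id) (≡.sym (count-lookup (λ x → col x Int.≟ c) D))

columnCells-unique : ∀ D c → Unique (columnCells D c)
columnCells-unique D c = Uniqueₚ.filter⁺ (inColumn? D c) (Uniqueₚ.allFin⁺ (length D))

columnCells-col : ∀ D c z → col (cell D (lookup (columnCells D c) z)) ≡ c
columnCells-col D c z = proj₂ (Memₚ.∈-filter⁻ (inColumn? D c) {xs = allFin (length D)} (Memₚ.∈-lookup z))

overfull-column : ∀ {k} (D : List Cell) (c : ℤ) → k < columnSize D c → (f : Fin (length D) → Fin k) →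
                  ∃ λ a → ∃ λ b → a ≢ b × col (cell D a) ≡ col (cell D b) × f a ≡ f b
overfull-column {k} D c k<size f
  with Finₚ.pigeonhole (≡.subst (k <_) (≡.sym (columnCells-length D c)) k<size) (f ∘ lookup (columnCells D c))
... | x , y , x<y , fx≡fy = lookup cells x , lookup cells y , x≢y ∘ lookup-injective cells (columnCells-unique D c) x y
                          , ≡.trans (columnCells-col D c x) (≡.sym (columnCells-col D c y)) , fx≡fy
  where
  cells : List (Fin (length D))
  cells = columnCells D c
  x≢y : x ≢ y
  x≢y = Finₚ.<⇒≢ x<y

module YoungSymmetrizer {c ℓ : Level} (K : CommutativeRing c ℓ) (k : ℕ) (D : List Cell) where

  open CommutativeRing K renaming (refl to ≈-refl)
  open RingProperties ring using (-‿distribˡ-*)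
  open SetoidReasoning setoid
  open Signs K
  open ListSums K
  open CharacteristicZero K
  open Indicator K

  n : ℕ
  n = length D

  term : (f g : Fin n → Fin k) (p q : Fin n → Fin n) → Carrier
  term f g p q = sgn K q * indicator K (f ∘ q ∘ p) g

  -- The coefficient of e_g in e_f y_D; by definition applyYoung K D k x g = Σ_f x(f) · coefficient f g.
  coefficient : (f g : Fin n → Fin k) → Carrier
  coefficient f g = sumK K (concatMap (λ p → map (term f g p) (colStab D)) (rowStab D))

  coefficient-by-rows : ∀ f g → coefficient f g ≈ sumK K (map (λ p → sumK K (map (term f g p) (colStab D))) (rowStab D))
  coefficient-by-rows f g = sumK-concatMap (λ p → map (term f g p) (colStab D)) (rowStab D)

  RowPreserving ColumnPreserving : (Fin n → Fin n) → Set
  RowPreserving    σ = ∀ i → row (cell D (σ i)) ≡ row (cell D i)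
  ColumnPreserving σ = ∀ i → col (cell D (σ i)) ≡ col (cell D i)

  rowPreserving? : ∀ σ → Dec (RowPreserving σ)
  rowPreserving? σ = Finₚ.all? (λ i → row (cell D (σ i)) Int.≟ row (cell D i))

  columnPreserving? : ∀ σ → Dec (ColumnPreserving σ)
  columnPreserving? σ = Finₚ.all? (λ i → col (cell D (σ i)) Int.≟ col (cell D i))

  ∈-rowStab⁻ : ∀ {p} → p ∈ rowStab D → IsPerm p × RowPreserving p
  ∈-rowStab⁻ p∈ with Memₚ.∈-filter⁻ rowPreserving? {xs = allPerms n} p∈
  ... | p∈perms , p-rows = proj₂ (Memₚ.∈-filter⁻ isPerm? {xs = allFuns n n} p∈perms) , p-rows

  ∈-colStab⁻ : ∀ {q} → q ∈ colStab D → IsPerm q × ColumnPreserving q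
  ∈-colStab⁻ q∈ with Memₚ.∈-filter⁻ columnPreserving? {xs = allPerms n} q∈
  ... | q∈perms , q-cols = proj₂ (Memₚ.∈-filter⁻ isPerm? {xs = allFuns n n} q∈perms) , q-cols

  identity-in-stabilizers : ∃ λ e → e ∈ rowStab D × e ∈ colStab D × (∀ i → e i ≡ i)
  identity-in-stabilizers with allFuns-complete n n id
  ... | e , e∈ , e≗id = e , in-stab rowPreserving? (λ i → ≡.cong (row ∘ cell D) (e≗id i))
                         , in-stab columnPreserving? (λ i → ≡.cong (col ∘ cell D) (e≗id i)) , e≗id
    where
    e-perm : IsPerm e
    e-perm = IsPerm-resp-≗ (λ i → ≡.sym (e≗id i)) (λ i j eq → eq)
    in-stab : ∀ {P : Pred (Fin n → Fin n) 0ℓ} (P? : Decidable P) → P e → e ∈ filter P? (allPerms n)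
    in-stab P? Pe = Memₚ.∈-filter⁺ P? (Memₚ.∈-filter⁺ isPerm? e∈ e-perm) Pe

  inColStab : ((Fin n → Fin n) → Carrier) → (Fin n → Fin n) → Carrier
  inColStab F q = onlyIf (isPerm? q) (onlyIf (columnPreserving? q) (F q))

  sumK-colStab : ∀ F → sumK K (map F (colStab D)) ≈ sumK K (map (inColStab F) (allFuns n n))
  sumK-colStab F = trans (sumK-filter columnPreserving? F (allPerms n))
                         (sumK-filter isPerm? (λ q → onlyIf (columnPreserving? q) (F q)) (allFuns n n))

  -- If K has no 2-torsion and f takes equal values on two distinct cells a, b of one
  -- column, then e_f y_D = 0: q ↦ (a b) q is a sign-reversing involution of C(D)
  -- which does not change f ∘ q ∘ p.
  module Vanishing (x≈-x⇒x≈0 : ∀ x → x ≈ - x → x ≈ 0#) where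

    coefficient-vanishes : ∀ f g {a b} → a ≢ b → col (cell D a) ≡ col (cell D b) → f a ≡ f b → coefficient f g ≈ 0#
    coefficient-vanishes f g {a} {b} a≢b same-column fa≡fb =
      trans (coefficient-by-rows f g) (sumK-zero (rowStab D) column-sum-vanishes)
      where
      t : Fin n → Fin n
      t = swap a b

      term-negated : ∀ p q → IsPerm q → term f g p (t ∘ q) ≈ - term f g p q
      term-negated p q q-perm = begin
        sgn K (t ∘ q) * indicator K (f ∘ (t ∘ q) ∘ p) g  ≈⟨ *-cong (sgn-swap a≢b q q-perm) (reflexive (indicator-congˡ g (λ i → swap-invariant f fa≡fb (q (p i))))) ⟩
        - sgn K q * indicator K (f ∘ q ∘ p) g            ≈⟨ -‿distribˡ-* _ _ ⟨
        - term f g p q                                   ∎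

      columns-kept : ∀ q → ColumnPreserving (t ∘ q) → ColumnPreserving q
      columns-kept q tq-cols i = ≡.trans (≡.sym (swap-invariant (col ∘ cell D) same-column (q i))) (tq-cols i)

      columns-kept⁻ : ∀ q → ColumnPreserving q → ColumnPreserving (t ∘ q)
      columns-kept⁻ q q-cols i = ≡.trans (swap-invariant (col ∘ cell D) same-column (q i)) (q-cols i)

      weighted-negated : ∀ p q → inColStab (term f g p) (t ∘ q) ≈ - inColStab (term f g p) q
      weighted-negated p q = onlyIf-negate (isPerm? (t ∘ q)) (isPerm? q)
        (λ tq-perm i j eq → tq-perm i j (≡.cong t eq)) (IsPerm-∘ (swap-IsPerm a b))
        (λ tq-perm → onlyIf-negate (columnPreserving? (t ∘ q)) (columnPreserving? q) (columns-kept q) (columns-kept⁻ q)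
          (λ _ → term-negated p q (λ i j eq → tq-perm i j (≡.cong t eq))))

      weighted-extensional : ∀ p → Extensional (inColStab (term f g p))
      weighted-extensional p q q' q≗q' = onlyIf-cong (isPerm? q) (isPerm? q')
        (IsPerm-resp-≗ q≗q') (IsPerm-resp-≗ (≡.sym ∘ q≗q'))
        (λ _ → onlyIf-cong (columnPreserving? q) (columnPreserving? q')
          (λ q-cols i → ≡.trans (≡.cong (col ∘ cell D) (≡.sym (q≗q' i))) (q-cols i))
          (λ q'-cols i → ≡.trans (≡.cong (col ∘ cell D) (q≗q' i)) (q'-cols i))
          (λ _ → reflexive (≡.cong₂ _*_ (sgn-cong q≗q') (indicator-congˡ g (λ i → ≡.cong f (q≗q' (p i)))))))

      column-sum-vanishes : ∀ p → sumK K (map (term f g p) (colStab D)) ≈ 0#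
      column-sum-vanishes p = x≈-x⇒x≈0 _ (begin
        sumK K (map (term f g p) (colStab D))          ≈⟨ sumK-colStab (term f g p) ⟩
        sumK K (map H (allFuns n n))                   ≈⟨ sumK-allFuns-reindex n n t (swap-IsPerm a b) H (weighted-extensional p) ⟨
        sumK K (map (λ q → H (t ∘ q)) (allFuns n n))   ≈⟨ sumK-cong (allFuns n n) (weighted-negated p) ⟩
        sumK K (map (λ q → - H q) (allFuns n n))       ≈⟨ sumK-neg H (allFuns n n) ⟩
        - sumK K (map H (allFuns n n))                 ≈⟨ -‿cong (sumK-colStab (term f g p)) ⟨
        - sumK K (map (term f g p) (colStab D))        ∎)
        where
        H : (Fin n → Fin n) → Carrier
        H = inColStab (term f g p)

    young-vanishes : ∀ j → k < columnSize D j → ∀ x g → applyYoung K D k x g ≈ 0#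
    young-vanishes j k<size x g = sumK-zero (allFuns n k) vanishing-term
      where
      vanishing-term : ∀ f → x f * coefficient f g ≈ 0#
      vanishing-term f with overfull-column D j k<size f
      ... | a , b , a≢b , same-column , fa≡fb = trans (*-congˡ (coefficient-vanishes f g a≢b same-column fa≡fb)) (zeroʳ _)

  -- If no column has more than k cells, label each cell by its column rank, f₀ : D → Fin k.
  -- In characteristic zero the coordinate of e_{f₀} y_D at e_{f₀} is nonzero: by rigidity
  -- of the rank, f₀ ∘ q ∘ p = f₀ forces q = id, so it counts the p ∈ R(D) fixing f₀.
  module Nonvanishing (char0 : CharZero K) (D-unique : Unique D) (columns-fit : ∀ j → columnSize D j ≤ k) where

    open ColumnRank D D-unique using (rank; rank<columnSize; module Rigidity)

    f₀ : Fin n → Fin k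
    f₀ j = Fin.fromℕ< (ℕₚ.<-≤-trans (rank<columnSize j) (columns-fit (col (cell D j))))

    f₀-rank : ∀ {i j} → f₀ i ≡ f₀ j → rank i ≡ rank j
    f₀-rank {i} {j} eq = ≡.trans (≡.sym (Finₚ.toℕ-fromℕ< _)) (≡.trans (≡.cong toℕ eq) (Finₚ.toℕ-fromℕ< _))

    natural-weighted : ∀ {m} {f g : Fin n → Fin m} {x} → ((∀ i → f i ≡ g i) → Natural x) → Natural (indicator K f g * x)
    natural-weighted {f = f} {g} {x} nat = by-cases (f ≟fun g)
      where
      by-cases : Dec (∀ i → f i ≡ g i) → Natural (indicator K f g * x)
      by-cases (yes f≗g) = Natural-resp (trans (*-congʳ (reflexive (indicator-≗ f≗g))) (*-identityˡ x)) (nat f≗g)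
      by-cases (no f≭g)  = Natural-resp (trans (*-congʳ (reflexive (indicator-≭ f≭g))) (zeroˡ x)) natural-0

    term-natural : ∀ {f p q} → (∀ i → f i ≡ f₀ i) → p ∈ rowStab D → q ∈ colStab D → Natural (term f f₀ p q)
    term-natural {f} {p} {q} f≗f₀ p∈ q∈ with ∈-rowStab⁻ p∈ | ∈-colStab⁻ q∈
    ... | p-perm , p-rows | q-perm , q-cols = Natural-resp (*-comm _ _) (natural-weighted sign-one)
      where
      sign-one : (∀ i → f (q (p i)) ≡ f₀ i) → Natural (sgn K q)
      sign-one fqp≗f₀ = Natural-resp (reflexive (≡.trans (sgn-cong q≗id) (sgn-id n))) (positive⇒natural positive-1)
        where
        q≗id : ∀ i → q i ≡ i
        q≗id = Rigidity.q-identity p q p-perm q-perm p-rows q-cols (λ i → f₀-rank (≡.trans (≡.sym (f≗f₀ (q (p i)))) (fqp≗f₀ i)))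

    coefficient-positive : ∀ {f} → (∀ i → f i ≡ f₀ i) → Positive (coefficient f f₀)
    coefficient-positive {f} f≗f₀ with identity-in-stabilizers
    ... | e , e∈R , e∈C , e≗id = Positive-resp (coefficient-by-rows f f₀)
      (positive-sum (λ p → sumK K (map (term f f₀ p) (colStab D))) (rowStab D)
        (λ {p} p∈ → natural-sum (term f f₀ p) (colStab D) (term-natural f≗f₀ p∈)) e∈R
        (positive-sum (term f f₀ e) (colStab D) (term-natural f≗f₀ e∈R) e∈C identity-term))
      where
      identity-term : Positive (term f f₀ e e)
      identity-term = Positive-resp
        (reflexive (≡.cong₂ _*_ (≡.trans (sgn-cong e≗id) (sgn-id n))
                                (indicator-≗ (λ i → ≡.trans (≡.cong f (≡.trans (e≗id (e i)) (e≗id i))) (f≗f₀ i)))))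
        (Positive-resp (*-identityˡ 1#) positive-1)

    diagonal-positive : Positive (applyYoung K D k (indicator K f₀) f₀)
    diagonal-positive with allFuns-complete n k f₀
    ... | f , f∈ , f≗f₀ = positive-sum (λ f' → indicator K f₀ f' * coefficient f' f₀) (allFuns n k)
      (λ _ → natural-weighted (λ f₀≗f' → positive⇒natural (coefficient-positive (≡.sym ∘ f₀≗f'))))
      f∈ (Positive-resp (trans (*-congʳ (reflexive (indicator-≗ (≡.sym ∘ f≗f₀)))) (*-identityˡ _)) (coefficient-positive f≗f₀))

    young-nonzero : VD≢0 K D k
    young-nonzero = indicator K f₀ , f₀ , positive≉0 char0 diagonal-positive

open YoungSymmetrizer

corollary4p18 : ∀ {c ℓ : Level} (K : CommutativeRing c ℓ) → IsField K → CharZero K →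
    (k : ℕ) (D : List Cell) → Unique D →
    VD≢0 K D k ⇔ (∀ (j : ℤ) → columnSize D j ≤ k)
corollary4p18 K K-field char0 k D D-unique = mk⇔ columns-fit (Nonvanishing.young-nonzero K k D char0 D-unique)
  where
  open CharacteristicZero K using (x≈-x⇒x≈0)
  columns-fit : VD≢0 K D k → ∀ j → columnSize D j ≤ k
  columns-fit (x , g , nonzero) j with columnSize D j Nat.≤? k
  ... | yes fits = fits
  ... | no overfull = ⊥-elim (nonzero (Vanishing.young-vanishes K k D (x≈-x⇒x≈0 K-field char0) j (ℕₚ.≰⇒> overfull) x g))
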